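{- Let $\mathbb{F}$ be a field of positive characteristic $p$ and $S=\{R_0,\dots,R_d\}$ an association scheme on a finite set $X$ with $O^\vartheta(S)\subseteq O_\vartheta(S)$. Let $\langle v\rangle_{\mathbb{F}}$ be a trivial $\mathbb{F}S$-submodule of the regular $\mathbb{F}S$-module. If $R_0\in U(v)$, then $\langle S_{p'}\rangle\subseteq U(v)$.
   Context: $S$ is an association scheme on $X$ with diagonal $R_0$, transposes $R_{i^*}$, intersection numbers $p_{ij}^k$, valencies $k_i=p_{ii^*}^0$. $S_{p'}=\{R_i\in S:p\nmid k_i\}$. For nonempty $U,V\subseteq S$, $UV=\{R_k:\exists R_u\in U,R_v\in V,\ p_{uv}^k>0\}$. A nonempty $T\subseteq S$ is closed if $T^*T\subseteq T$ ($T^*=\{R_{i^*}:R_i\in T\}$), strongly normal if also $R_{i^*}TR_i\subseteq T$ for all $i$. $\langle H\rangle$ is the intersection of all closed subsets containing $H$. $O_\vartheta(S)=\{R_i:k_i=1\}$; $O^\vartheta(S)$ is the intersection of all strongly normal closed subsets. $\overline{A_i}$ is the image in $M_X(\mathbb{F})$ of the adjacency matrix of $R_i$, $\mathbb{F}S=\mathrm{span}_{\mathbb{F}}\{\overline{A_i}\}$ (basis $\overline{A_0},\dots,\overline{A_d}$), $\overline{k_i}$ the image of $k_i$ in $\mathbb{F}$. For $v=\sum c_i\overline{A_i}$, $U(v)=\{R_i:c_i\ne0\}$. A trivial submodule of the regular module is $\langle v\rangle_{\mathbb{F}}$ with $0\ne v\in\mathbb{F}S$ and $\overline{A_i}v=\overline{k_i}v$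 for all $i$. -}

module Defs where

open import Level using (Level; _⊔_)
open import Data.Nat as ℕ using (ℕ; zero; suc; _>_)
open import Data.Nat.Divisibility using (_∣_; _∣?_)
open import Data.Vec using (tabulate)
open import Data.Nat.Primality using (Prime)
open import Data.Fin using (Fin; zero; suc; _≟_)
open import Data.Fin.Subset using (Subset; _∈_; _⊆_; Nonempty)
open import Data.Bool using (Bool; true; false; _∧_; not; if_then_else_)
open import Data.Product using (Σ; ∃; ∃-syntax; _×_; _,_)
open import Relation.Nullary using (¬_)
open import Relation.Nullary.Decidable using (⌊_⌋)
open import Relation.Binary.PropositionalEquality using (_≡_)
open import Algebra.Bundles using (CommutativeRing)

record Field (c ℓ : Level) : Set (Level.suc (c ⊔ ℓ)) where
  field
    commutativeRing : CommutativeRing c ℓ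
  open CommutativeRing commutativeRing public
  field
    1≉0     : ¬ (1# ≈ 0#)
    inverse : ∀ x → ¬ (x ≈ 0#) → ∃[ y ] (x * y ≈ 1#)

module _ {c ℓ} (F : Field c ℓ) where
  open Field F using (Carrier; 0#; 1#; _+_)

  ι : ℕ → Carrier
  ι zero    = 0#
  ι (suc n) = 1# + ι n

  ΣF : (n : ℕ) → (Fin n → Carrier) → Carrier
  ΣF zero    f = 0#
  ΣF (suc n) f = f zero + ΣF n (λ i → f (suc i))

-- F has characteristic p (p prime, p·1 = 0; for a field this means char F = p)
HasCharacteristic : ∀ {c ℓ} → Field c ℓ → ℕ → Set ℓ
HasCharacteristic F p = Prime p × (ι F p ≈ 0#)
  where open Field F using (_≈_; 0#)

count : (n : ℕ) → (Fin n → Bool) → ℕ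
count zero    f = zero
count (suc n) f with f zero
... | true  = suc (count n (λ i → f (suc i)))
... | false = count n (λ i → f (suc i))

-- Association scheme S = {R_0,…,R_d} on X = Fin n.
-- rel x y = i  means (x,y) ∈ R_i  (the R_i partition X × X).

record AssociationScheme (n d : ℕ) : Set where
  field
    rel        : Fin n → Fin n → Fin (suc d)
    diag→      : ∀ x y → rel x y ≡ zero → x ≡ y
    →diag      : ∀ x → rel x x ≡ zero
    nonempty   : ∀ i → ∃[ x ] ∃[ y ] (rel x y ≡ i)
    tr         : Fin (suc d) → Fin (suc d)
    tr-spec    : ∀ x y → rel y x ≡ tr (rel x y)
    p          : Fin (suc d) → Fin (suc d) → Fin (suc d) → ℕ
    p-spec     : ∀ i j k x y → rel x y ≡ k →
                 count n (λ z → ⌊ rel x z ≟ i ⌋ ∧ ⌊ rel z y ≟ j ⌋) ≡ p i j k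

  Idx : Set
  Idx = Fin (suc d)

  val : Idx → ℕ
  val i = p i (tr i) zero

  -- closed subsets: nonempty, T* T ⊆ T
  Closed : Subset (suc d) → Set
  Closed T = Nonempty T ×
    (∀ i j k → i ∈ T → j ∈ T → p (tr i) j k > 0 → k ∈ T)

  -- strongly normal closed subsets: closed and R_{i*} T R_i ⊆ T for all i
  StronglyNormalClosed : Subset (suc d) → Set
  StronglyNormalClosed T = Closed T ×
    (∀ i t m k → t ∈ T → p (tr i) t m > 0 → p m i k > 0 → k ∈ T)

  In⟨_⟩ : Subset (suc d) → Idx → Set
  In⟨ H ⟩ k = ∀ T → Closed T → H ⊆ T → k ∈ T

  -- R_k ∈ O^ϑ(S) : intersection of all strongly normal closed subsets
  InOupper : Idx → Set
  InOupper k = ∀ T → StronglyNormalClosed T → k ∈ T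

  -- R_k ∈ O_ϑ(S)
  InOlower : Idx → Set
  InOlower k = val k ≡ 1

  Sp' : ℕ → Subset (suc d)
  Sp' q = tabulate (λ i → not ⌊ q ∣? val i ⌋)

-- The algebra FS inside M_X(F).  An element v = Σ_i c_i Ā_i is given by
-- its coefficient vector c; as an X×X matrix, v x y = c (rel x y).

module _ {c ℓ} (F : Field c ℓ) {n d : ℕ} (S : AssociationScheme n d) where
  open Field F using (Carrier; 0#; 1#; _+_; _*_; _≈_)
  open AssociationScheme S

  Ā : Idx → Fin n → Fin n → Carrier
  Ā i x y = if ⌊ rel x y ≟ i ⌋ then 1# else 0#

  mat : (Idx → Carrier) → Fin n → Fin n → Carrier
  mat cv x y = ΣF F (suc d) (λ i → cv i * Ā i x y)

  Āmul : Idx → (Idx → Carrier) → Fin n → Fin n → Carrier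
  Āmul i cv x y = ΣF F n (λ z → Ā i x z * mat cv z y)

  -- ⟨v⟩_F is a trivial submodule of the regular FS-module:
  -- v ≠ 0 and Ā_i v = k̄_i v for all i
  TrivialGenerator : (Idx → Carrier) → Set ℓ
  TrivialGenerator cv =
    (¬ (∀ x y → mat cv x y ≈ 0#)) ×
    (∀ i x y → Āmul i cv x y ≈ ι F (val i) * mat cv x y)

  InU : (Idx → Carrier) → Idx → Set ℓ
  InU cv i = ¬ (cv i ≈ 0#)

{-# OPTIONS --safe #-}
module Submission where

-- Write v = Σ cᵢ Āᵢ, so v(x,y) = c_{rel x y}, and call v invariant along R_k if
-- v(x,y) = v(z,y) whenever (x,z) ∈ R_k; the indices of invariance contain R_0 and are
-- closed. Entry (x,y) of Āᵢ v = k̄ᵢ v reads Σ_{z ∈ xRᵢ} v(z,y) = k̄ᵢ v(x,y). For thin R_g the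
-- sum has a single term, so v is invariant along R_g. If p ∤ kᵢ, any z, z' ∈ xRᵢ satisfy
-- (z',z) ∈ R_{i*}R_i ⊆ O^ϑ(S) ⊆ O_ϑ(S), so v(-,y) is constant on xRᵢ, and cancelling
-- k̄ᵢ ≠ 0 gives invariance along R_i. Hence v is invariant along every relation of
-- ⟨S_{p'}⟩, and invariance along R_i forces cᵢ = c₀ ≠ 0. Invariance is undecidable while
-- closed subsets are decidable, but the goal is a negation, so excluded middle is available.

open import Defs
open import Level using (Level)
open import Data.Nat as ℕ using (ℕ; suc; _>_; _≤_; z≤n; s≤s)
open import Data.Nat.Properties using (<⇒≱; ≤-reflexive)
open import Data.Nat.Divisibility using (_∣_; _∣?_)
open import Data.Nat.Primality using (Prime; prime⇒irreducible)
open import Data.Nat.Coprimality using (Coprime; coprime-Bézout)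
open import Data.Nat.GCD using (module Bézout)
open import Data.Fin using (Fin; zero; suc; _≟_)
open import Data.Fin.Properties using (sequence)
open import Data.Fin.Subset using (_∈_)
open import Data.Vec using (tabulate)
open import Data.Vec.Properties using (lookup∘tabulate; []=⇒lookup; lookup⇒[]=)
open import Data.Bool using (Bool; true; false; T; _∧_; not; if_then_else_)
open import Data.Bool.Properties using (T-≡; T-∧)
open import Data.Product using (∃-syntax; _×_; _,_)
open import Data.Sum using (inj₁; inj₂)
open import Function using (_∘_; Equivalence)
open import Effect.Monad using (RawMonad)
open import Relation.Nullary using (¬_; yes; no)
open import Relation.Nullary.Negation using (¬¬-Monad; contradiction)
open import Relation.Nullary.Decidable using (⌊_⌋; isYes≗does; toWitness; fromWitness; toWitnessFalse; ¬¬-excluded-middle)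
open import Relation.Binary.PropositionalEquality as ≡ using (_≡_; refl; cong)

count-pos : ∀ n (b : Fin n → Bool) {w} → T (b w) → count n b > 0
count-pos (suc n) b {zero} t with b zero | t
... | true  | _  = s≤s z≤n
... | false | ()
count-pos (suc n) b {suc w} t with b zero
... | true  = s≤s z≤n
... | false = count-pos n (b ∘ suc) t

count-witness : ∀ n (b : Fin n → Bool) → count n b > 0 → ∃[ w ] T (b w)
count-witness (suc n) b c with b zero in b₀
... | true  = zero , Equivalence.from T-≡ b₀
... | false with count-witness n (b ∘ suc) c
...   | w , t = suc w , t

count-cong : ∀ n {b b′ : Fin n → Bool} → (∀ w → b w ≡ b′ w) → count n b ≡ count n b′
count-cong ℕ.zero    eq = refl
count-cong (suc n) {b} {b′} eq with b zero | b′ zero | eq zero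
... | true  | true  | refl = cong suc (count-cong n (eq ∘ suc))
... | false | false | refl = count-cong n (eq ∘ suc)

count≤1⇒unique : ∀ n (b : Fin n → Bool) {w w′} → count n b ≤ 1 → T (b w) → T (b w′) → w ≡ w′
count≤1⇒unique (suc n) b {zero} {zero} _ _ _ = refl
count≤1⇒unique (suc n) b {zero} {suc w′} c t t′ with b zero | t
... | true  | _  = contradiction (ℕ.s≤s⁻¹ c) (<⇒≱ (count-pos n (b ∘ suc) t′))
... | false | ()
count≤1⇒unique (suc n) b {suc w} {zero} c t t′ with b zero | t′
... | true  | _  = contradiction (ℕ.s≤s⁻¹ c) (<⇒≱ (count-pos n (b ∘ suc) t))
... | false | ()
count≤1⇒unique (suc n) b {suc w} {suc w′} c t t′ with b zero
... | true  = contradiction (ℕ.s≤s⁻¹ c) (<⇒≱ (count-pos n (b ∘ suc) t))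
... | false = cong suc (count≤1⇒unique n (b ∘ suc) c t t′)

count-const-false : ∀ n → count n (λ _ → false) ≡ 0
count-const-false ℕ.zero    = refl
count-const-false (suc n) = count-const-false n

count-≟ : ∀ {n} (r : Fin n) → count n (λ i → ⌊ r ≟ i ⌋) ≡ 1
count-≟ {suc n} zero    = cong suc (count-const-false n)
count-≟ {suc n} (suc r) = ≡.trans (count-cong n ⌊suc≟suc⌋) (count-≟ r)
  where
  ⌊suc≟suc⌋ : ∀ i → ⌊ suc r ≟ suc i ⌋ ≡ ⌊ r ≟ i ⌋
  ⌊suc≟suc⌋ i = ≡.trans (isYes≗does (suc r ≟ suc i)) (≡.sym (isYes≗does (r ≟ i)))

∈-tabulate⁺ : ∀ {m} (f : Fin m → Bool) {k} → T (f k) → k ∈ tabulate f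
∈-tabulate⁺ f {k} t = lookup⇒[]= k _ (≡.trans (lookup∘tabulate f k) (Equivalence.to T-≡ t))

∈-tabulate⁻ : ∀ {m} (f : Fin m → Bool) {k} → k ∈ tabulate f → T (f k)
∈-tabulate⁻ f {k} k∈ = Equivalence.from T-≡ (≡.trans (≡.sym (lookup∘tabulate f k)) ([]=⇒lookup k∈))

prime∤⇒coprime : ∀ {q m} → Prime q → ¬ q ∣ m → Coprime q m
prime∤⇒coprime pq q∤m (d∣q , d∣m) with prime⇒irreducible pq d∣q
... | inj₁ d≡1 = d≡1
... | inj₂ refl = contradiction d∣m q∤m

module FieldProperties {c ℓ} (F : Field c ℓ) where
  open Field F hiding (zero) renaming (refl to ≈-refl)
  open import Relation.Binary.Reasoning.Setoid setoid

  ι-+ : ∀ a b → ι F (a ℕ.+ b) ≈ ι F a + ι F b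
  ι-+ ℕ.zero  b = sym (+-identityˡ _)
  ι-+ (suc a) b = trans (+-congˡ (ι-+ a b)) (sym (+-assoc _ _ _))

  ι-* : ∀ a b → ι F (a ℕ.* b) ≈ ι F a * ι F b
  ι-* ℕ.zero  b = sym (zeroˡ _)
  ι-* (suc a) b = begin
    ι F (b ℕ.+ a ℕ.* b)      ≈⟨ ι-+ b (a ℕ.* b) ⟩
    ι F b + ι F (a ℕ.* b)    ≈⟨ +-cong (sym (*-identityˡ _)) (ι-* a b) ⟩
    1# * ι F b + ι F a * ι F b ≈⟨ sym (distribʳ _ _ _) ⟩
    (1# + ι F a) * ι F b     ∎

  ι-1 : ι F 1 ≈ 1#
  ι-1 = +-identityʳ 1#

  ι-Bézout⇒1≈0 : ∀ a b x y → ι F a ≈ 0# → ι F b ≈ 0# → 1 ℕ.+ x ℕ.* a ≡ y ℕ.* b → 1# ≈ 0#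
  ι-Bézout⇒1≈0 a b x y ιa≈0 ιb≈0 eq = begin
    1#                   ≈⟨ sym (+-identityʳ _) ⟩
    1# + 0#              ≈⟨ +-congˡ (sym (trans (*-congˡ ιa≈0) (zeroʳ _))) ⟩
    1# + ι F x * ι F a   ≈⟨ +-congˡ (sym (ι-* x a)) ⟩
    ι F (1 ℕ.+ x ℕ.* a)  ≡⟨ cong (ι F) eq ⟩
    ι F (y ℕ.* b)        ≈⟨ ι-* y b ⟩
    ι F y * ι F b        ≈⟨ *-congˡ ιb≈0 ⟩
    ι F y * 0#           ≈⟨ zeroʳ _ ⟩
    0#                   ∎

  coprime⇒ι≉0 : ∀ {a b} → Coprime a b → ι F a ≈ 0# → ¬ ι F b ≈ 0#
  coprime⇒ι≉0 {a} {b} cop ιa≈0 ιb≈0 with coprime-Bézout cop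
  ... | Bézout.+- x y eq = 1≉0 (ι-Bézout⇒1≈0 b a y x ιb≈0 ιa≈0 eq)
  ... | Bézout.-+ x y eq = 1≉0 (ι-Bézout⇒1≈0 a b x y ιa≈0 ιb≈0 eq)

  characteristic∤⇒ι≉0 : ∀ {q m} → HasCharacteristic F q → ¬ q ∣ m → ¬ ι F m ≈ 0#
  characteristic∤⇒ι≉0 (pq , ιq≈0) q∤m = coprime⇒ι≉0 (prime∤⇒coprime pq q∤m) ιq≈0

  *-cancelˡ-≉0 : ∀ k {a b} → ¬ k ≈ 0# → k * a ≈ k * b → a ≈ b
  *-cancelˡ-≉0 k {a} {b} k≉0 ka≈kb with inverse k k≉0
  ... | k⁻¹ , kk⁻¹≈1 = begin
    a               ≈⟨ sym (*-identityˡ a) ⟩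
    1# * a          ≈⟨ *-congʳ k⁻¹k≈1 ⟨
    (k⁻¹ * k) * a   ≈⟨ *-assoc _ _ _ ⟩
    k⁻¹ * (k * a)   ≈⟨ *-congˡ ka≈kb ⟩
    k⁻¹ * (k * b)   ≈⟨ *-assoc _ _ _ ⟨
    (k⁻¹ * k) * b   ≈⟨ *-congʳ k⁻¹k≈1 ⟩
    1# * b          ≈⟨ *-identityˡ b ⟩
    b               ∎
    where k⁻¹k≈1 = trans (*-comm k⁻¹ k) kk⁻¹≈1

  ΣF-cong : ∀ n {f g : Fin n → Carrier} → (∀ i → f i ≈ g i) → ΣF F n f ≈ ΣF F n g
  ΣF-cong ℕ.zero  f≈g = ≈-refl
  ΣF-cong (suc n) f≈g = +-cong (f≈g zero) (ΣF-cong n (f≈g ∘ suc))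

  ΣF-select : ∀ n (b : Fin n → Bool) (f : Fin n → Carrier) {a} → (∀ w → T (b w) → f w ≈ a) →
              ΣF F n (λ w → (if b w then 1# else 0#) * f w) ≈ ι F (count n b) * a
  ΣF-select ℕ.zero  b f         f≈a = sym (zeroˡ _)
  ΣF-select (suc n) b f {a} f≈a with b zero | f≈a zero
  ... | true  | f₀≈a = begin
    1# * f zero + _                          ≈⟨ +-cong (trans (*-identityˡ _) (f₀≈a _)) (ΣF-select n _ _ (f≈a ∘ suc)) ⟩
    a + ι F (count n (b ∘ suc)) * a          ≈⟨ +-congʳ (sym (*-identityˡ a)) ⟩
    1# * a + ι F (count n (b ∘ suc)) * a     ≈⟨ sym (distribʳ _ _ _) ⟩
    (1# + ι F (count n (b ∘ suc))) * a       ∎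
  ... | false | _ = trans (+-cong (zeroˡ _) (ΣF-select n _ _ (f≈a ∘ suc))) (+-identityˡ _)

module SchemeProperties {n d : ℕ} (S : AssociationScheme n d) where
  open AssociationScheme S

  isRel : Idx → Fin n → Fin n → Bool
  isRel i x z = ⌊ rel x z ≟ i ⌋

  isRel⁺ : ∀ {i x z} → rel x z ≡ i → T (isRel i x z)
  isRel⁺ = fromWitness

  isRel⁻ : ∀ {i x z} → T (isRel i x z) → rel x z ≡ i
  isRel⁻ = toWitness

  tr-involutive : ∀ i → tr (tr i) ≡ i
  tr-involutive i with nonempty i
  ... | x , y , refl = ≡.trans (cong tr (≡.sym (tr-spec x y))) (≡.sym (tr-spec y x))

  p>0⁺ : ∀ {i j k x y z} → rel x y ≡ k → rel x z ≡ i → rel z y ≡ j → p i j k > 0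
  p>0⁺ {i} {j} {k} {x} {y} {z} xy xz zy = ≡.subst (_> 0) (p-spec i j k x y xy)
    (count-pos n (λ w → isRel i x w ∧ isRel j w y) (Equivalence.from T-∧ (isRel⁺ xz , isRel⁺ zy)))

  p>0⁻ : ∀ {i j k x y} → rel x y ≡ k → p i j k > 0 → ∃[ z ] (rel x z ≡ i × rel z y ≡ j)
  p>0⁻ {i} {j} {k} {x} {y} xy pos
    with count-witness n (λ w → isRel i x w ∧ isRel j w y) (≡.subst (_> 0) (≡.sym (p-spec i j k x y xy)) pos)
  ... | z , t with Equivalence.to (T-∧ {isRel i x z}) t
  ...   | xz , zy = z , isRel⁻ xz , isRel⁻ zy

  count-isRel≡val : ∀ i x → count n (isRel i x) ≡ val i
  count-isRel≡val i x = ≡.trans (count-cong n redundant-conjunct) (p-spec i (tr i) zero x x (→diag x))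
    where
    redundant-conjunct : ∀ z → isRel i x z ≡ (isRel i x z ∧ isRel (tr i) z x)
    redundant-conjunct z with rel x z ≟ i
    ... | yes xz = ≡.sym (Equivalence.to T-≡ (isRel⁺ (≡.trans (tr-spec x z) (cong tr xz))))
    ... | no _ = refl

  thin⇒unique : ∀ {g x z z′} → val g ≡ 1 → rel x z ≡ g → rel x z′ ≡ g → z ≡ z′
  thin⇒unique {g} {x} vg xz xz′ =
    count≤1⇒unique n (isRel g x) (≤-reflexive (≡.trans (count-isRel≡val g x) vg))
      (isRel⁺ xz) (isRel⁺ xz′)

  zero∈Closed : ∀ {T} → Closed T → zero ∈ T
  zero∈Closed ((t , t∈T) , closed) with nonempty t
  ... | x , y , xy = closed t t zero t∈T t∈T
    (p>0⁺ (→diag y) (≡.trans (tr-spec x y) (cong tr xy)) xy)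

  p[i*,i]>0⇒InOupper : ∀ i {g} → p (tr i) i g > 0 → InOupper g
  p[i*,i]>0⇒InOupper i pos T (closed , normal) with nonempty (tr i)
  ... | x , y , xy = normal i zero (tr i) _ (zero∈Closed closed) (p>0⁺ xy xy (→diag y)) pos

  closure⊆¬¬ : ∀ {a} (P : Idx → Set a) → P zero → (∀ i j k → P i → P j → p (tr i) j k > 0 → P k) →
               ∀ {H} → (∀ k → k ∈ H → P k) → ∀ k → In⟨ H ⟩ k → ¬ ¬ P k
  closure⊆¬¬ P P₀ P-closed H⊆P k k∈⟨H⟩ ¬Pk =
    sequence (RawMonad.rawApplicative ¬¬-Monad) (λ _ → ¬¬-excluded-middle) λ P? →
      let T⁺ = tabulate (λ i → ⌊ P? i ⌋)
          from : ∀ {i} → i ∈ T⁺ → P i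
          from {i} i∈ = toWitness {a? = P? i} (∈-tabulate⁻ (λ i → ⌊ P? i ⌋) i∈)
          to : ∀ {i} → P i → i ∈ T⁺
          to {i} Pi = ∈-tabulate⁺ (λ i → ⌊ P? i ⌋) (fromWitness {a? = P? i} Pi)
          closed : Closed T⁺
          closed = (zero , to P₀) , λ i j k i∈ j∈ pos → to (P-closed i j k (from i∈) (from j∈) pos)
      in ¬Pk (from (k∈⟨H⟩ T⁺ closed (λ {i} i∈H → to (H⊆P i i∈H))))

module TrivialSubmodule {c ℓ} (F : Field c ℓ) {n d : ℕ} (S : AssociationScheme n d)
  (v : AssociationScheme.Idx S → Field.Carrier F)
  (trivial : ∀ i x y → Field._≈_ F (Āmul F S i v x y)
                                   (Field._*_ F (ι F (AssociationScheme.val S i)) (mat F S v x y)))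
  where
  open Field F hiding (zero) renaming (refl to ≈-refl)
  open AssociationScheme S
  open FieldProperties F
  open SchemeProperties S
  open import Relation.Binary.Reasoning.Setoid setoid

  mat≈coeff : ∀ x y → mat F S v x y ≈ v (rel x y)
  mat≈coeff x y = begin
    ΣF F (suc d) (λ i → v i * Ā F S i x y)                    ≈⟨ ΣF-cong (suc d) (λ i → *-comm (v i) (Ā F S i x y)) ⟩
    ΣF F (suc d) (λ i → Ā F S i x y * v i)                    ≈⟨ ΣF-select (suc d) (λ i → ⌊ rel x y ≟ i ⌋) v
                                                                   (λ i t → reflexive (cong v (≡.sym (toWitness t)))) ⟩
    ι F (count (suc d) (λ i → ⌊ rel x y ≟ i ⌋)) * v (rel x y) ≡⟨ cong (λ m → ι F m * v (rel x y)) (count-≟ (rel x y)) ⟩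
    ι F 1 * v (rel x y)                                        ≈⟨ trans (*-congʳ ι-1) (*-identityˡ _) ⟩
    v (rel x y)                                                ∎

  constant-on-row⇒ : ∀ i x y {a} → (∀ z → rel x z ≡ i → v (rel z y) ≈ a) →
                     ι F (val i) * a ≈ ι F (val i) * v (rel x y)
  constant-on-row⇒ i x y {a} const = begin
    ι F (val i) * a               ≡⟨ cong (λ m → ι F m * a) (≡.sym (count-isRel≡val i x)) ⟩
    ι F (count n (isRel i x)) * a ≈⟨ ΣF-select n (isRel i x) (λ z → mat F S v z y)
                                       (λ z t → trans (mat≈coeff z y) (const z (isRel⁻ t))) ⟨
    Āmul F S i v x y              ≈⟨ trivial i x y ⟩
    ι F (val i) * mat F S v x y   ≈⟨ *-congˡ (mat≈coeff x y) ⟩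
    ι F (val i) * v (rel x y)     ∎

  Invariant : Idx → Set ℓ
  Invariant k = ∀ x z y → rel x z ≡ k → v (rel x y) ≈ v (rel z y)

  Invariant-zero : Invariant zero
  Invariant-zero x z y xz = reflexive (cong (λ w → v (rel w y)) (diag→ x z xz))

  Invariant-tr : ∀ {i} → Invariant i → Invariant (tr i)
  Invariant-tr {i} inv x z y xz =
    sym (inv z x y (≡.trans (tr-spec x z) (≡.trans (cong tr xz) (tr-involutive i))))

  Invariant-closed : ∀ i j k → Invariant i → Invariant j → p (tr i) j k > 0 → Invariant k
  Invariant-closed i j k invᵢ invⱼ pos x z y xz with p>0⁻ xz pos
  ... | w , xw , wz = trans (Invariant-tr invᵢ x w y xw) (invⱼ w z y wz)

  Invariant⇒coeff≈coeff₀ : ∀ {i} → Invariant i → v i ≈ v zero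
  Invariant⇒coeff≈coeff₀ {i} inv with nonempty i
  ... | x , y , refl = trans (inv x y y refl) (reflexive (cong v (→diag y)))

  thin⇒Invariant : ∀ {g} → val g ≡ 1 → Invariant g
  thin⇒Invariant {g} vg x z y xz = sym (*-cancelˡ-≉0 (ι F (val g)) ιvg≉0
    (constant-on-row⇒ g x y (λ z′ xz′ → reflexive (cong (λ w → v (rel w y)) (thin⇒unique vg xz′ xz)))))
    where
    ιvg≉0 : ¬ ι F (val g) ≈ 0#
    ιvg≉0 ιvg≈0 = 1≉0 (trans (sym ι-1) (≡.subst (λ m → ι F m ≈ 0#) vg ιvg≈0))

  ∤val⇒Invariant : (∀ g → InOupper g → InOlower g) → ∀ {q} → HasCharacteristic F q →
                   ∀ {i} → ¬ q ∣ val i → Invariant i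
  ∤val⇒Invariant O^⊆O_ char {i} q∤val x z y xz = sym (*-cancelˡ-≉0 (ι F (val i))
    (characteristic∤⇒ι≉0 char q∤val)
    (constant-on-row⇒ i x y (λ z′ xz′ → thin⇒Invariant
      (O^⊆O_ _ (p[i*,i]>0⇒InOupper i (p>0⁺ refl (≡.trans (tr-spec x z′) (cong tr xz′)) xz)))
      z′ z y refl)))

lemma4p7 : ∀ {c ℓ : Level} (F : Field c ℓ) (q : ℕ) → HasCharacteristic F q →
    ∀ {n d : ℕ} (S : AssociationScheme n d) →
    (∀ i → AssociationScheme.InOupper S i → AssociationScheme.InOlower S i) →
    (v : AssociationScheme.Idx S → Field.Carrier F) →
    TrivialGenerator F S v →
    InU F S v zero →
    ∀ i → AssociationScheme.In⟨_⟩ S (AssociationScheme.Sp' S q) i → InU F S v i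
lemma4p7 F q char S O^⊆O_ v (_ , trivial) v₀≉0 i i∈⟨Sp′⟩ vᵢ≈0 =
  closure⊆¬¬ Invariant Invariant-zero Invariant-closed Sp′⊆Invariant i i∈⟨Sp′⟩
    (λ inv → v₀≉0 (trans (sym (Invariant⇒coeff≈coeff₀ inv)) vᵢ≈0))
  where
  open Field F using (trans; sym)
  open AssociationScheme S
  open SchemeProperties S
  open TrivialSubmodule F S v trivial

  Sp′⊆Invariant : ∀ k → k ∈ Sp' q → Invariant k
  Sp′⊆Invariant k k∈ = ∤val⇒Invariant O^⊆O_ char
    (toWitnessFalse (∈-tabulate⁻ (λ k → not ⌊ q ∣? val k ⌋) k∈))
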